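{- Let $n\ge r\ge 1$ be integers and $q$ a prime power, and set $\delta_q:=3$ if $q$ is odd and $q\ge5$, $\delta_q:=1$ if $q$ is even, and $\delta_q:=5/3$ if $q=3$. Then there exists a Kakeya set $K\subseteq\mathbb{F}_q^n$ of rank $r$ such that $$|K|\le\left(1-\frac{q-\delta_q}{2q^r}\right)^{\lfloor n/(r+1)\rfloor}q^n.$$
   Context: $\mathbb{F}_q$ denotes the finite field with $q$ elements. For a finite vector space $V$ and an integer $0\le r\le\dim V$, a subset $K\subseteq V$ is a Kakeya set of rank $r$ if for every subspace $L\le V$ with $\dim L=r$ there exists $v\in V$ such that $v+L\subseteq K$. -}

module Defs where

open import Level using (0ℓ)
open import Data.Nat as ℕ using (ℕ; zero; suc)
open import Data.Nat.DivMod using (_%_)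
open import Data.Fin using (Fin)
open import Data.Vec using (Vec; zipWith; replicate; foldr)
open import Data.Product using (Σ; _×_; ∃; ∃-syntax)
open import Data.List using (List)
open import Data.List.Membership.Propositional using (_∈_)
open import Data.Integer using (+_)
open import Data.Rational as ℚ using (ℚ; _/_; _*_; _-_; _+_; 1ℚ; 0ℚ)
open import Relation.Binary.PropositionalEquality using (_≡_; _≢_)
open import Relation.Nullary using (¬_)
open import Algebra.Structures using (IsCommutativeRing)

-- A field structure on the carrier Fin q (with propositional equality).
-- Every finite field with q elements is isomorphic to one of these.
record FieldOn (q : ℕ) : Set where
  field
    _+F_ _*F_ : Fin q → Fin q → Fin q
    -F_ : Fin q → Fin q
    0F 1F : Fin q
    isCommutativeRing : IsCommutativeRing _≡_ _+F_ _*F_ -F_ 0F 1F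
    0≢1 : 0F ≢ 1F
    inv : Fin q → Fin q
    inv-r : ∀ x → x ≢ 0F → x *F inv x ≡ 1F

module _ {q : ℕ} (F : FieldOn q) where
  open FieldOn F

  Vecn : ℕ → Set
  Vecn n = Vec (Fin q) n

  _⊕_ : ∀ {n} → Vecn n → Vecn n → Vecn n
  _⊕_ = zipWith _+F_

  _·_ : ∀ {n} → Fin q → Vecn n → Vecn n
  c · v = Data.Vec.map (c *F_) v

  zeroV : ∀ {n} → Vecn n
  zeroV = replicate _ 0F

  lincomb : ∀ {n r} → Vec (Fin q) r → Vec (Vecn n) r → Vecn n
  lincomb c b = foldr _ _⊕_ zeroV (zipWith _·_ c b)

  LinIndep : ∀ {n r} → Vec (Vecn n) r → Set
  LinIndep {r = r} b = ∀ (c : Vec (Fin q) r) → lincomb c b ≡ zeroV → c ≡ replicate r 0F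

  -- K is a Kakeya set of rank r: every r-dimensional subspace L
  -- (= span of r linearly independent vectors b) has a translate v + L ⊆ K.
  IsKakeya : ∀ {n} (r : ℕ) → List (Vecn n) → Set
  IsKakeya {n} r K =
    ∀ (b : Vec (Vecn n) r) → LinIndep b →
      ∃[ v ] (∀ (c : Vec (Fin q) r) → (v ⊕ lincomb c b) ∈ K)

_^ℚ_ : ℚ → ℕ → ℚ
x ^ℚ zero = 1ℚ
x ^ℚ suc k = x * (x ^ℚ k)

-- 1/m as a rational (m = 0 gives 0, never used at 0)
recip : ℕ → ℚ
recip zero = 0ℚ
recip (suc k) = + 1 / suc k

fromℕ : ℕ → ℚ
fromℕ m = + m / 1

δ : ℕ → ℚ
δ q with q % 2
... | zero = 1ℚ
... | suc _ with q
...   | 3 = + 5 / 3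
...   | _ = + 3 / 1

kakeyaBound : ℕ → ℕ → ℕ → ℚ
kakeyaBound q n r =
  ((1ℚ - (fromℕ q - δ q) * recip (2 ℕ.* q ℕ.^ r)) ^ℚ (n ℕ./ suc r)) * fromℕ (q ℕ.^ n)

{-# OPTIONS --safe #-}
-- Let K₂ ⊆ 𝔽_q² consist of the points (s + t, s t) and of the points (0, y) with y not of the
-- form −m². For every linear form a₁x + a₂y some level set lies in K₂: if a₂ ≠ 0 it is the line
-- y = μ(x − μ), μ = −a₁/a₂, traced by s = μ; if a₂ = 0 it is the axis x = 0, covered by s = −t
-- and the missed values. Hence B = {(x, y, w) ∈ 𝔽_q^{r+1} : w ≠ 0 or (x, y) ∈ K₂} contains a
-- level set of every nonzero linear form, so a translate of every subspace of dimension r,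
-- which lies in the kernel of such a form. This property survives products, so B^k × 𝔽_q^t
-- with n = k(r + 1) + t is a Kakeya set of rank r. Counting, |B| ≤ q^{r+1} − q(q − 1)/2 + N, where
-- N ≤ q − 2 is the number of missed values, and N = 0 when q is even (then 1 + 1 = 0 and m ↦ −m²
-- is injective). As q + 2N ≤ δ_q q, this is at most (1 − (q − δ_q)/(2q^r)) q^{r+1}.
module Submission where

open import Defs using (FieldOn; IsKakeya; fromℕ; recip; δ; _^ℚ_; kakeyaBound)
import Defs
open import Level using (0ℓ)
open import Data.Nat as ℕ using (ℕ; zero; suc; _≤_; _<_; z≤n; s≤s)
import Data.Nat.Properties as ℕₚ
open import Data.Nat.DivMod using (_%_; [m+kn]%n≡m%n; m≡m%n+[m/n]*n)
open import Data.Nat.Tactic.RingSolver using (solve-∀)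
import Data.Nat.Coprimality as Coprime
import Data.Integer as ℤ
import Data.Integer.Properties as ℤₚ
open import Data.Rational using () renaming (_≤_ to _≤ℚ_)
import Data.Rational as ℚ
import Data.Rational.Properties as ℚₚ
open import Data.Rational.Solver using (module +-*-Solver)
open import Data.Fin as Fin using (Fin)
import Data.Fin.Properties as Finₚ
open import Data.Vec as Vec using (Vec; []; _∷_)
import Data.Vec.Properties as Vecₚ
open import Data.List as List using (List; []; _∷_; length; map; filter; _++_; cartesianProductWith; allFin)
import Data.List.Properties as Listₚ
open import Data.List.Membership.Propositional using (_∈_; find)
open import Data.List.Membership.Propositional.Properties
open import Data.List.Relation.Binary.Subset.Propositional using (_⊆_)
open import Data.List.Relation.Unary.Any using (here; there)
open import Data.List.Relation.Unary.All as All using (All; []; _∷_; all?)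
import Data.List.Relation.Unary.All.Properties as Allₚ
open import Data.List.Relation.Unary.Unique.Propositional using (Unique; []; _∷_)
import Data.List.Relation.Unary.Unique.Propositional.Properties as Uniqueₚ
open import Data.Product using (∃-syntax; _×_; _,_; proj₂)
import Data.Product.Properties as Productₚ
open import Data.Sum using (_⊎_; inj₁; inj₂)
open import Data.Empty using (⊥; ⊥-elim)
open import Function using (_∘_; _∘′_)
open import Relation.Nullary using (Dec; yes; no; ¬_; ¬?)
open import Relation.Nullary.Decidable using (_⊎-dec_)
open import Relation.Unary using (Pred; Decidable)
open import Relation.Binary.Definitions using (tri<; tri≈; tri>)
open import Relation.Binary.PropositionalEquality
open import Algebra.Bundles using (CommutativeRing)
import Algebra.Properties.Ring as RingProperties
import Algebra.Properties.CommutativeSemigroup as CommutativeSemigroupProperties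

module _ {a} {A : Set a} where

  ∈-remove : ∀ {x y : A} (xs ys : List A) → y ∈ xs ++ x ∷ ys → y ≢ x → y ∈ xs ++ ys
  ∈-remove []       ys (here y≡x)  y≢x = ⊥-elim (y≢x y≡x)
  ∈-remove []       ys (there y∈)  _   = y∈
  ∈-remove (_ ∷ xs) ys (here y≡z)  _   = here y≡z
  ∈-remove (_ ∷ xs) ys (there y∈)  y≢x = there (∈-remove xs ys y∈ y≢x)

  length-++-∷ : ∀ (xs ys : List A) {x} → length (xs ++ x ∷ ys) ≡ suc (length (xs ++ ys))
  length-++-∷ []       ys = refl
  length-++-∷ (_ ∷ xs) ys = cong suc (length-++-∷ xs ys)

  Unique-⊆⇒length≤ : ∀ {xs ys : List A} → Unique xs → xs ⊆ ys → length xs ≤ length ys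
  Unique-⊆⇒length≤ {[]}     _            _    = z≤n
  Unique-⊆⇒length≤ {x ∷ xs} (x∉xs ∷ !xs) xs⊆ys with us , vs , refl ← ∈-∃++ (xs⊆ys (here refl)) =
    ℕₚ.≤-trans (s≤s (Unique-⊆⇒length≤ !xs xs⊆us++vs)) (ℕₚ.≤-reflexive (sym (length-++-∷ us vs)))
    where
    xs⊆us++vs : xs ⊆ us ++ vs
    xs⊆us++vs z∈xs = ∈-remove us vs (xs⊆ys (there z∈xs)) λ { refl → All.lookup x∉xs z∈xs refl }

module _ {a b c} {A : Set a} {B : Set b} {C : Set c} where

  length-cartesianProductWith : ∀ (f : A → B → C) xs ys →
    length (cartesianProductWith f xs ys) ≡ length xs ℕ.* length ys
  length-cartesianProductWith f []       ys = refl
  length-cartesianProductWith f (x ∷ xs) ys = begin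
    length (map (f x) ys ++ cartesianProductWith f xs ys)
      ≡⟨ Listₚ.length-++ (map (f x) ys) ⟩
    length (map (f x) ys) ℕ.+ length (cartesianProductWith f xs ys)
      ≡⟨ cong₂ ℕ._+_ (Listₚ.length-map (f x) ys) (length-cartesianProductWith f xs ys) ⟩
    length ys ℕ.+ length xs ℕ.* length ys ∎
    where open ≡-Reasoning

module _ {a} {A : Set a} where

  unorderedPairs : List A → List (A × A)
  unorderedPairs []       = []
  unorderedPairs (x ∷ xs) = map (x ,_) (x ∷ xs) ++ unorderedPairs xs

  length-unorderedPairs : ∀ xs → 2 ℕ.* length (unorderedPairs xs) ≡ length xs ℕ.* suc (length xs)
  length-unorderedPairs []       = refl
  length-unorderedPairs (x ∷ xs) = begin
    2 ℕ.* length (map (x ,_) (x ∷ xs) ++ unorderedPairs xs)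
      ≡⟨ cong (2 ℕ.*_) (Listₚ.length-++ (map (x ,_) (x ∷ xs))) ⟩
    2 ℕ.* (length (map (x ,_) (x ∷ xs)) ℕ.+ length (unorderedPairs xs))
      ≡⟨ cong (λ l → 2 ℕ.* (l ℕ.+ length (unorderedPairs xs))) (Listₚ.length-map (x ,_) (x ∷ xs)) ⟩
    2 ℕ.* (suc (length xs) ℕ.+ length (unorderedPairs xs))
      ≡⟨ ℕₚ.*-distribˡ-+ 2 (suc (length xs)) (length (unorderedPairs xs)) ⟩
    2 ℕ.* suc (length xs) ℕ.+ 2 ℕ.* length (unorderedPairs xs)
      ≡⟨ cong (2 ℕ.* suc (length xs) ℕ.+_) (length-unorderedPairs xs) ⟩
    2 ℕ.* suc (length xs) ℕ.+ length xs ℕ.* suc (length xs)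
      ≡⟨ triangle (length xs) ⟩
    suc (length xs) ℕ.* suc (suc (length xs)) ∎
    where
    open ≡-Reasoning
    triangle : ∀ n → 2 ℕ.* suc n ℕ.+ n ℕ.* suc n ≡ suc n ℕ.* suc (suc n)
    triangle = solve-∀

  ∈-unorderedPairs : ∀ {xs} {s t : A} → s ∈ xs → t ∈ xs →
    (s , t) ∈ unorderedPairs xs ⊎ (t , s) ∈ unorderedPairs xs
  ∈-unorderedPairs {x ∷ xs} (here refl) t∈ = inj₁ (∈-++⁺ˡ (∈-map⁺ (x ,_) t∈))
  ∈-unorderedPairs {x ∷ xs} (there s∈) (here refl) = inj₂ (∈-++⁺ˡ (∈-map⁺ (x ,_) (there s∈)))
  ∈-unorderedPairs {x ∷ xs} (there s∈) (there t∈) with ∈-unorderedPairs s∈ t∈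
  ... | inj₁ st∈ = inj₁ (∈-++⁺ʳ (map (x ,_) (x ∷ xs)) st∈)
  ... | inj₂ ts∈ = inj₂ (∈-++⁺ʳ (map (x ,_) (x ∷ xs)) ts∈)

length-allFin : ∀ n → length (allFin n) ≡ n
length-allFin n = Listₚ.length-tabulate {n = n} (λ x → x)

module _ {a} {A : Set a} where

  vecsOver : List A → ∀ m → List (Vec A m)
  vecsOver xs zero    = [] ∷ []
  vecsOver xs (suc m) = cartesianProductWith _∷_ xs (vecsOver xs m)

  length-vecsOver : ∀ xs m → length (vecsOver xs m) ≡ length xs ℕ.^ m
  length-vecsOver xs zero    = refl
  length-vecsOver xs (suc m) =
    trans (length-cartesianProductWith _∷_ xs (vecsOver xs m)) (cong (length xs ℕ.*_) (length-vecsOver xs m))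

  vecsOver⁺ : ∀ {xs} → Unique xs → ∀ m → Unique (vecsOver xs m)
  vecsOver⁺ !xs zero    = [] ∷ []
  vecsOver⁺ !xs (suc m) = Uniqueₚ.cartesianProductWith⁺ _∷_ Vecₚ.∷-injective !xs (vecsOver⁺ !xs m)

  ∈-vecsOver : ∀ {xs} → (∀ x → x ∈ xs) → ∀ {m} (v : Vec A m) → v ∈ vecsOver xs m
  ∈-vecsOver ∈xs []      = here refl
  ∈-vecsOver ∈xs (x ∷ v) = ∈-cartesianProductWith⁺ _∷_ (∈xs x) (∈-vecsOver ∈xs v)

  replicate-++ : ∀ m {n} (x : A) → Vec.replicate (m ℕ.+ n) x ≡ Vec.replicate m x Vec.++ Vec.replicate n x
  replicate-++ zero    x = refl
  replicate-++ (suc m) x = cong (x ∷_) (replicate-++ m x)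

  zipWith-++-take-drop : ∀ m {n r} (b : Vec (Vec A (m ℕ.+ n)) r) →
    Vec.zipWith Vec._++_ (Vec.map (Vec.take m) b) (Vec.map (Vec.drop m) b) ≡ b
  zipWith-++-take-drop m []      = refl
  zipWith-++-take-drop m (x ∷ b) = cong₂ _∷_ (Vecₚ.take++drop≡id m x) (zipWith-++-take-drop m b)

module _ {n} (σ : Fin n → Fin n) (σ-involutive : ∀ x → σ (σ x) ≡ x) where

  private
    σ-injective : ∀ {x y} → σ x ≡ σ y → x ≡ y
    σ-injective {x} {y} σx≡σy = trans (sym (σ-involutive x)) (trans (cong σ σx≡σy) (σ-involutive y))

    length-filter-σ : ∀ {p q} {P : Pred (Fin n) p} {Q : Pred (Fin n) q} (P? : Decidable P) (Q? : Decidable Q) →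
      (∀ {x} → P x → Q (σ x)) → length (filter P? (allFin n)) ≤ length (filter Q? (allFin n))
    length-filter-σ P? Q? P⇒Qσ = subst (_≤ _) (Listₚ.length-map σ (filter P? (allFin n)))
      (Unique-⊆⇒length≤ (Uniqueₚ.map⁺ σ-injective (Uniqueₚ.filter⁺ P? (Uniqueₚ.allFin⁺ n))) σ[P]⊆Q)
      where
      σ[P]⊆Q : map σ (filter P? (allFin n)) ⊆ filter Q? (allFin n)
      σ[P]⊆Q z∈ with x , x∈ , refl ← ∈-map⁻ σ z∈ =
        ∈-filter⁺ Q? (∈-allFin (σ x)) (P⇒Qσ (proj₂ (∈-filter⁻ P? {xs = allFin n} x∈)))

  involution-with-unique-fixedPoint⇒odd : ∀ {x₀} → σ x₀ ≡ x₀ → (∀ x → σ x ≡ x → x ≡ x₀) → n % 2 ≡ 1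
  involution-with-unique-fixedPoint⇒odd {x₀} σx₀≡x₀ fixed⇒x₀ = begin
    n % 2                            ≡⟨ cong (_% 2) n≡1+2a ⟩
    suc (length A ℕ.+ length A) % 2  ≡⟨ cong (_% 2) (odd-form (length A)) ⟩
    (1 ℕ.+ length A ℕ.* 2) % 2       ≡⟨ [m+kn]%n≡m%n 1 (length A) 2 ⟩
    1 ∎
    where
    open ≡-Reasoning
    A D O : List (Fin n)
    A = filter (λ x → x Fin.<? σ x) (allFin n)
    D = filter (λ x → σ x Fin.<? x) (allFin n)
    O = x₀ ∷ A ++ D

    odd-form : ∀ a → suc (a ℕ.+ a) ≡ 1 ℕ.+ a ℕ.* 2
    odd-form = solve-∀

    |A|≡|D| : length A ≡ length D
    |A|≡|D| = ℕₚ.≤-antisym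
      (length-filter-σ _ _ λ {x} x<σx → subst (λ y → y Fin.< σ x) (sym (σ-involutive x)) x<σx)
      (length-filter-σ _ _ λ {x} σx<x → subst (λ y → σ x Fin.< y) (sym (σ-involutive x)) σx<x)

    allFin⊆O : allFin n ⊆ O
    allFin⊆O {x} _ with Finₚ.<-cmp x (σ x)
    ... | tri< x<σx _ _ = there (∈-++⁺ˡ (∈-filter⁺ _ (∈-allFin x) x<σx))
    ... | tri≈ _ x≡σx _ = here (fixed⇒x₀ x (sym x≡σx))
    ... | tri> _ _ σx<x = there (∈-++⁺ʳ A (∈-filter⁺ _ (∈-allFin x) σx<x))

    x₀∉A++D : All (x₀ ≢_) (A ++ D)
    x₀∉A++D = All.tabulate λ { x∈ refl → x₀∉ (∈-++⁻ A x∈) }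
      where
      x₀∉ : x₀ ∈ A ⊎ x₀ ∈ D → ⊥
      x₀∉ (inj₁ x₀∈A) = Finₚ.<-irrefl (sym σx₀≡x₀) (proj₂ (∈-filter⁻ _ {xs = allFin n} x₀∈A))
      x₀∉ (inj₂ x₀∈D) = Finₚ.<-irrefl σx₀≡x₀ (proj₂ (∈-filter⁻ _ {xs = allFin n} x₀∈D))

    Unique-O : Unique O
    Unique-O = x₀∉A++D ∷ Uniqueₚ.++⁺ (Uniqueₚ.filter⁺ _ (Uniqueₚ.allFin⁺ n)) (Uniqueₚ.filter⁺ _ (Uniqueₚ.allFin⁺ n))
      λ (x∈A , x∈D) → Finₚ.<-asym (proj₂ (∈-filter⁻ _ {xs = allFin n} x∈A)) (proj₂ (∈-filter⁻ _ {xs = allFin n} x∈D))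

    n≡1+2a : n ≡ suc (length A ℕ.+ length A)
    n≡1+2a = begin
      n                ≡⟨ length-allFin n ⟨
      length (allFin n) ≡⟨ ℕₚ.≤-antisym (Unique-⊆⇒length≤ (Uniqueₚ.allFin⁺ n) allFin⊆O)
                                         (Unique-⊆⇒length≤ Unique-O (λ {x} _ → ∈-allFin x)) ⟩
      length O          ≡⟨ cong suc (Listₚ.length-++ A) ⟩
      suc (length A ℕ.+ length D) ≡⟨ cong (λ d → suc (length A ℕ.+ d)) |A|≡|D| ⟨
      suc (length A ℕ.+ length A) ∎

injective⇒surjective : ∀ {n} {f : Fin n → Fin n} → (∀ {x y} → f x ≡ f y → x ≡ y) → ∀ y → ∃[ x ] f x ≡ y
injective⇒surjective {zero}  _     ()
injective⇒surjective {suc n} {f} f-injective y with Finₚ.any? (λ x → f x Finₚ.≟ y)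
... | yes y∈image = y∈image
... | no  y∉image = ⊥-elim (ℕₚ.<-irrefl refl (Finₚ.injective⇒≤ punchOut-injective))
  where
  y≢f : ∀ x → y ≢ f x
  y≢f x y≡fx = y∉image (x , sym y≡fx)
  punchOut-injective : ∀ {x x′} → Fin.punchOut (y≢f x) ≡ Fin.punchOut (y≢f x′) → x ≡ x′
  punchOut-injective e = f-injective (Finₚ.punchOut-injective (y≢f _) (y≢f _) e)

module FieldProperties {q : ℕ} (F : FieldOn q) where

  open FieldOn F public
    renaming (_+F_ to infixl 6 _+_; _*F_ to infixl 7 _*_; -F_ to infix 8 -_; 0F to 0#; 1F to 1#; 0≢1 to 0#≢1#)

  commutativeRing : CommutativeRing 0ℓ 0ℓ
  commutativeRing = record { isCommutativeRing = isCommutativeRing }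

  open CommutativeRing commutativeRing public
    using ( +-comm; +-assoc; +-identityˡ; +-identityʳ; -‿inverseˡ; -‿inverseʳ
          ; *-comm; *-assoc; *-identityˡ; *-identityʳ; zeroˡ; zeroʳ; distribˡ; distribʳ)
  open RingProperties (CommutativeRing.ring commutativeRing) public
    using (-‿distribˡ-*; -‿distribʳ-*; -‿involutive; -‿injective; -0#≈0#; +-inverseʳ-unique)
  open CommutativeSemigroupProperties (CommutativeRing.+-commutativeSemigroup commutativeRing) public
    using () renaming (interchange to +-interchange)
  open ≡-Reasoning

  _≟_ : (x y : Fin q) → Dec (x ≡ y)
  _≟_ = Finₚ._≟_

  *-inverseˡ : ∀ x → x ≢ 0# → inv x * x ≡ 1#
  *-inverseˡ x x≢0 = trans (*-comm (inv x) x) (inv-r x x≢0)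

  *-cancelˡ : ∀ {x y z} → x ≢ 0# → x * y ≡ x * z → y ≡ z
  *-cancelˡ {x} {y} {z} x≢0 xy≡xz = begin
    y                ≡⟨ *-identityˡ y ⟨
    1# * y           ≡⟨ cong (_* y) (*-inverseˡ x x≢0) ⟨
    (inv x * x) * y  ≡⟨ *-assoc (inv x) x y ⟩
    inv x * (x * y)  ≡⟨ cong (inv x *_) xy≡xz ⟩
    inv x * (x * z)  ≡⟨ *-assoc (inv x) x z ⟨
    (inv x * x) * z  ≡⟨ cong (_* z) (*-inverseˡ x x≢0) ⟩
    1# * z           ≡⟨ *-identityˡ z ⟩
    z                ∎

  x*y≡0⇒y≡0 : ∀ {x y} → x ≢ 0# → x * y ≡ 0# → y ≡ 0#
  x*y≡0⇒y≡0 {x} x≢0 xy≡0 = *-cancelˡ x≢0 (trans xy≡0 (sym (zeroʳ x)))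

  [1+1]*x≡x+x : ∀ x → (1# + 1#) * x ≡ x + x
  [1+1]*x≡x+x x = trans (distribʳ x 1# 1#) (cong₂ _+_ (*-identityˡ x) (*-identityˡ x))

  -x≡x⇒x≡0 : ∀ {x} → 1# + 1# ≢ 0# → - x ≡ x → x ≡ 0#
  -x≡x⇒x≡0 {x} 2≢0 -x≡x = x*y≡0⇒y≡0 2≢0 (begin
    (1# + 1#) * x  ≡⟨ [1+1]*x≡x+x x ⟩
    x + x          ≡⟨ cong (x +_) -x≡x ⟨
    x + - x        ≡⟨ -‿inverseʳ x ⟩
    0#             ∎)

  x+y≡z⇒y≡-x+z : ∀ {x y z} → x + y ≡ z → y ≡ - x + z
  x+y≡z⇒y≡-x+z {x} {y} {z} x+y≡z = begin
    y              ≡⟨ +-identityˡ y ⟨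
    0# + y         ≡⟨ cong (_+ y) (-‿inverseˡ x) ⟨
    - x + x + y    ≡⟨ +-assoc (- x) x y ⟩
    - x + (x + y)  ≡⟨ cong (- x +_) x+y≡z ⟩
    - x + z        ∎

  x*x≡0⇒x≡0 : ∀ {x} → x * x ≡ 0# → x ≡ 0#
  x*x≡0⇒x≡0 {x} x*x≡0 with x ≟ 0#
  ... | yes x≡0 = x≡0
  ... | no  x≢0 = x*y≡0⇒y≡0 x≢0 x*x≡0

  1+1≡0⇒x+x≡0 : 1# + 1# ≡ 0# → ∀ x → x + x ≡ 0#
  1+1≡0⇒x+x≡0 2≡0 x = trans (sym ([1+1]*x≡x+x x)) (trans (cong (_* x) 2≡0) (zeroˡ x))

  even⇒1+1≡0 : q % 2 ≡ 0 → 1# + 1# ≡ 0#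
  even⇒1+1≡0 q-even with (1# + 1#) ≟ 0#
  ... | yes 2≡0 = 2≡0
  ... | no  2≢0 = ⊥-elim (ℕₚ.1+n≢0 (trans (sym q-odd) q-even))
    where
    q-odd : q % 2 ≡ 1
    q-odd = involution-with-unique-fixedPoint⇒odd -_ -‿involutive -0#≈0# (λ x → -x≡x⇒x≡0 2≢0)

module VectorSpace {q : ℕ} (F : FieldOn q) where

  open FieldProperties F
  open ≡-Reasoning

  Vecₙ : ℕ → Set
  Vecₙ = Defs.Vecn F

  _⊕_ : ∀ {n} → Vecₙ n → Vecₙ n → Vecₙ n
  _⊕_ = Defs._⊕_ F

  _·_ : ∀ {n} → Fin q → Vecₙ n → Vecₙ n
  _·_ = Defs._·_ F

  zeroV : ∀ {n} → Vecₙ n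
  zeroV = Defs.zeroV F

  lincomb : ∀ {n r} → Vec (Fin q) r → Vec (Vecₙ n) r → Vecₙ n
  lincomb = Defs.lincomb F

  infixl 6 _⊕_
  infixr 7 _·_
  infix 8 _∙_

  _∙_ : ∀ {n} → Vecₙ n → Vecₙ n → Fin q
  []       ∙ []       = 0#
  (a ∷ as) ∙ (x ∷ xs) = a * x + as ∙ xs

  ∙-distribˡ-⊕ : ∀ {n} (a x y : Vecₙ n) → a ∙ (x ⊕ y) ≡ a ∙ x + a ∙ y
  ∙-distribˡ-⊕ []       []       []       = sym (+-identityˡ 0#)
  ∙-distribˡ-⊕ (a ∷ as) (x ∷ xs) (y ∷ ys) = begin
    a * (x + y) + as ∙ (xs ⊕ ys)          ≡⟨ cong₂ _+_ (distribˡ a x y) (∙-distribˡ-⊕ as xs ys) ⟩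
    (a * x + a * y) + (as ∙ xs + as ∙ ys) ≡⟨ +-interchange (a * x) (a * y) (as ∙ xs) (as ∙ ys) ⟩
    (a * x + as ∙ xs) + (a * y + as ∙ ys) ∎

  ∙-·-comm : ∀ {n} (a : Vecₙ n) s x → a ∙ (s · x) ≡ s * (a ∙ x)
  ∙-·-comm []       s []       = sym (zeroʳ s)
  ∙-·-comm (a ∷ as) s (x ∷ xs) = begin
    a * (s * x) + as ∙ (s · xs)   ≡⟨ cong₂ _+_ a[sx]≡s[ax] (∙-·-comm as s xs) ⟩
    s * (a * x) + s * (as ∙ xs)   ≡⟨ distribˡ s (a * x) (as ∙ xs) ⟨
    s * (a * x + as ∙ xs)         ∎
    where
    a[sx]≡s[ax] : a * (s * x) ≡ s * (a * x)
    a[sx]≡s[ax] = trans (sym (*-assoc a s x)) (trans (cong (_* x) (*-comm a s)) (*-assoc s a x))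

  ∙-zeroʳ : ∀ {n} (a : Vecₙ n) → a ∙ zeroV ≡ 0#
  ∙-zeroʳ []       = refl
  ∙-zeroʳ (a ∷ as) = trans (cong₂ _+_ (zeroʳ a) (∙-zeroʳ as)) (+-identityˡ 0#)

  ∙-zeroˡ : ∀ {n} (x : Vecₙ n) → zeroV ∙ x ≡ 0#
  ∙-zeroˡ []       = refl
  ∙-zeroˡ (x ∷ xs) = trans (cong₂ _+_ (zeroˡ x) (∙-zeroˡ xs)) (+-identityˡ 0#)

  ∙-lincomb-≡0 : ∀ {n r} (a : Vecₙ n) (c : Vec (Fin q) r) (b : Vec (Vecₙ n) r) →
    All (λ u → a ∙ u ≡ 0#) (Vec.toList b) → a ∙ lincomb c b ≡ 0#
  ∙-lincomb-≡0 a []       []       _             = ∙-zeroʳ a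
  ∙-lincomb-≡0 a (c ∷ cs) (u ∷ us) (a∙u≡0 ∷ a⊥us) = begin
    a ∙ ((c · u) ⊕ lincomb cs us)         ≡⟨ ∙-distribˡ-⊕ a (c · u) (lincomb cs us) ⟩
    a ∙ (c · u) + a ∙ lincomb cs us       ≡⟨ cong₂ _+_ (∙-·-comm a c u) (∙-lincomb-≡0 a cs us a⊥us) ⟩
    c * (a ∙ u) + 0#                      ≡⟨ cong (λ t → c * t + 0#) a∙u≡0 ⟩
    c * 0# + 0#                           ≡⟨ cong (_+ 0#) (zeroʳ c) ⟩
    0# + 0#                               ≡⟨ +-identityˡ 0# ⟩
    0#                                    ∎

  ∙-surjective : ∀ {n} (a : Vecₙ n) → a ≢ zeroV → ∀ c → ∃[ w ] a ∙ w ≡ c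
  ∙-surjective []       a≢0 c = ⊥-elim (a≢0 refl)
  ∙-surjective (a ∷ as) a≢0 c with a ≟ 0#
  ... | no a≢0# = (inv a * c) ∷ zeroV , (begin
    a * (inv a * c) + as ∙ zeroV  ≡⟨ cong₂ _+_ (sym (*-assoc a (inv a) c)) (∙-zeroʳ as) ⟩
    (a * inv a) * c + 0#          ≡⟨ +-identityʳ _ ⟩
    (a * inv a) * c               ≡⟨ cong (_* c) (inv-r a a≢0#) ⟩
    1# * c                        ≡⟨ *-identityˡ c ⟩
    c                             ∎)
  ... | yes refl with w , as∙w≡c ← ∙-surjective as (a≢0 ∘′ cong (0# ∷_)) c =
    0# ∷ w , trans (cong (_+ as ∙ w) (zeroʳ 0#)) (trans (+-identityˡ _) as∙w≡c)

  module Elimination {n} (p : Vecₙ (suc n)) (pivot≢0 : Vec.head p ≢ 0#) where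

    private
      i : Fin q
      i = inv (Vec.head p)

    eliminate : Vecₙ (suc n) → Vecₙ n
    eliminate u = Vec.tail u ⊕ (- (Vec.head u * i) · Vec.tail p)

    lift : Vecₙ n → Vecₙ (suc n)
    lift a = - (i * (a ∙ Vec.tail p)) ∷ a

    lift-∙ : ∀ a u → lift a ∙ u ≡ a ∙ eliminate u
    lift-∙ a (x ∷ u) = begin
      - (i * d) * x + a ∙ u        ≡⟨ cong (_+ a ∙ u) coefficient ⟩
      - (x * i) * d + a ∙ u        ≡⟨ +-comm _ (a ∙ u) ⟩
      a ∙ u + - (x * i) * d        ≡⟨ cong (a ∙ u +_) (∙-·-comm a (- (x * i)) (Vec.tail p)) ⟨
      a ∙ u + a ∙ (- (x * i) · Vec.tail p) ≡⟨ ∙-distribˡ-⊕ a u _ ⟨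
      a ∙ eliminate (x ∷ u)        ∎
      where
      d : Fin q
      d = a ∙ Vec.tail p
      coefficient : - (i * d) * x ≡ - (x * i) * d
      coefficient = begin
        - (i * d) * x  ≡⟨ -‿distribˡ-* (i * d) x ⟨
        - (i * d * x)  ≡⟨ cong -_ (trans (*-assoc i d x) (trans (cong (i *_) (*-comm d x))
                                   (trans (sym (*-assoc i x d)) (cong (_* d) (*-comm i x))))) ⟩
        - (x * i * d)  ≡⟨ -‿distribˡ-* (x * i) d ⟩
        - (x * i) * d  ∎

    ∙-eliminate-pivot : ∀ a → a ∙ eliminate p ≡ 0#
    ∙-eliminate-pivot a = begin
      a ∙ eliminate p                      ≡⟨ ∙-distribˡ-⊕ a (Vec.tail p) _ ⟩
      d + a ∙ (- (Vec.head p * i) · Vec.tail p) ≡⟨ cong (d +_) (∙-·-comm a _ (Vec.tail p)) ⟩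
      d + - (Vec.head p * i) * d           ≡⟨ cong (λ t → d + - t * d) (inv-r (Vec.head p) pivot≢0) ⟩
      d + - 1# * d                         ≡⟨ cong (d +_) (-‿distribˡ-* 1# d) ⟨
      d + - (1# * d)                       ≡⟨ cong (λ t → d + - t) (*-identityˡ d) ⟩
      d + - d                              ≡⟨ -‿inverseʳ d ⟩
      0#                                   ∎
      where
      d : Fin q
      d = a ∙ Vec.tail p

    lift-≢0 : ∀ {a} → a ≢ zeroV → lift a ≢ zeroV
    lift-≢0 a≢0 = a≢0 ∘′ Vecₚ.∷-injectiveʳ

    lift-orthogonal : ∀ {a} xs ys → All (λ u → a ∙ eliminate u ≡ 0#) (xs ++ ys) →
      All (λ u → lift a ∙ u ≡ 0#) (xs ++ p ∷ ys)
    lift-orthogonal {a} xs ys a⊥ with a⊥xs , a⊥ys ← Allₚ.++⁻ xs a⊥ =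
      Allₚ.++⁺ (All.map (λ {u} → trans (lift-∙ a u)) a⊥xs)
               (trans (lift-∙ a p) (∙-eliminate-pivot a) ∷ All.map (λ {u} → trans (lift-∙ a u)) a⊥ys)

  ∃-orthogonal : ∀ n (us : List (Vecₙ n)) → length us < n →
    ∃[ a ] (a ≢ zeroV × All (λ u → a ∙ u ≡ 0#) us)
  ∃-orthogonal (suc n) us |us|<n with all? (λ u → Vec.head u ≟ 0#) us
  ... | yes heads≡0 = 1# ∷ zeroV , (λ e → 0#≢1# (sym (Vecₚ.∷-injectiveˡ e))) , All.map (λ {u} → e₀⊥ u) heads≡0
    where
    e₀⊥ : ∀ (u : Vecₙ (suc n)) → Vec.head u ≡ 0# → (1# ∷ zeroV) ∙ u ≡ 0#
    e₀⊥ (x ∷ u) refl = trans (cong₂ _+_ (zeroʳ 1#) (∙-zeroˡ u)) (+-identityˡ 0#)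
  ... | no ¬heads≡0 with find (Allₚ.¬All⇒Any¬ (λ u → Vec.head u ≟ 0#) us ¬heads≡0)
  ... | p , p∈us , pivot≢0 with xs , ys , refl ← ∈-∃++ p∈us =
    let open Elimination p pivot≢0
        a , a≢0 , a⊥rest = ∃-orthogonal n (map eliminate (xs ++ ys)) (shorter eliminate)
    in  lift a , lift-≢0 a≢0 , lift-orthogonal xs ys (Allₚ.map⁻ a⊥rest)
    where
    shorter : (f : Vecₙ (suc n) → Vecₙ n) → length (map f (xs ++ ys)) < n
    shorter f = subst (_< n) (sym (Listₚ.length-map f (xs ++ ys)))
                  (ℕₚ.≤-pred (subst (_< suc n) (length-++-∷ xs ys) |us|<n))

module Kakeya {q : ℕ} (F : FieldOn q) where

  open FieldProperties F
  open VectorSpace F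
  open ≡-Reasoning

  -- IsKakeya without independence of b, which is lost when b is split into blocks.
  IsStrongKakeya : ∀ {n} (r : ℕ) → List (Vecₙ n) → Set
  IsStrongKakeya {n} r K = ∀ (b : Vec (Vecₙ n) r) → ∃[ v ] (∀ c → v ⊕ lincomb c b ∈ K)

  levelSets⇒IsStrongKakeya : ∀ {r} (K : List (Vecₙ (suc r))) →
    (∀ a → a ≢ zeroV → ∃[ t ] (∀ z → a ∙ z ≡ t → z ∈ K)) → IsStrongKakeya r K
  levelSets⇒IsStrongKakeya {r} K level⊆K b =
    let a , a≢0 , a⊥b = ∃-orthogonal (suc r) (Vec.toList b) (s≤s (ℕₚ.≤-reflexive (Vecₚ.length-toList b)))
        t , level-t⊆K = level⊆K a a≢0
        w , a∙w≡t     = ∙-surjective a a≢0 t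
    in  w , λ c → level-t⊆K (w ⊕ lincomb c b) (begin
          a ∙ (w ⊕ lincomb c b)    ≡⟨ ∙-distribˡ-⊕ a w (lincomb c b) ⟩
          a ∙ w + a ∙ lincomb c b  ≡⟨ cong₂ _+_ a∙w≡t (∙-lincomb-≡0 a c b a⊥b) ⟩
          t + 0#                   ≡⟨ +-identityʳ t ⟩
          t                        ∎)

  ⊕-++ : ∀ {m n} (x x′ : Vecₙ m) (y y′ : Vecₙ n) → (x Vec.++ y) ⊕ (x′ Vec.++ y′) ≡ (x ⊕ x′) Vec.++ (y ⊕ y′)
  ⊕-++ []      []        y y′ = refl
  ⊕-++ (x ∷ xs) (x′ ∷ xs′) y y′ = cong (x + x′ ∷_) (⊕-++ xs xs′ y y′)

  lincomb-++ : ∀ {m n r} (c : Vec (Fin q) r) (us : Vec (Vecₙ m) r) (ws : Vec (Vecₙ n) r) →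
    lincomb c (Vec.zipWith Vec._++_ us ws) ≡ lincomb c us Vec.++ lincomb c ws
  lincomb-++ {m} []       []       []       = replicate-++ m 0#
  lincomb-++     (c ∷ cs) (u ∷ us) (w ∷ ws) = begin
    c · (u Vec.++ w) ⊕ lincomb cs (Vec.zipWith Vec._++_ us ws)
      ≡⟨ cong₂ _⊕_ (Vecₚ.map-++ (c *_) u w) (lincomb-++ cs us ws) ⟩
    (c · u Vec.++ c · w) ⊕ (lincomb cs us Vec.++ lincomb cs ws)
      ≡⟨ ⊕-++ (c · u) (lincomb cs us) (c · w) (lincomb cs ws) ⟩
    (c · u ⊕ lincomb cs us) Vec.++ (c · w ⊕ lincomb cs ws) ∎

  IsStrongKakeya-++ : ∀ {m n r} {A : List (Vecₙ m)} {B : List (Vecₙ n)} →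
    IsStrongKakeya r A → IsStrongKakeya r B → IsStrongKakeya r (cartesianProductWith Vec._++_ A B)
  IsStrongKakeya-++ {m} {n} {r} {A} {B} A-Kakeya B-Kakeya b =
    let v , v+span⊆A = A-Kakeya us
        w , w+span⊆B = B-Kakeya ws
    in  v Vec.++ w , λ c → subst (_∈ cartesianProductWith Vec._++_ A B) (concat-translates v w c)
                             (∈-cartesianProductWith⁺ Vec._++_ (v+span⊆A c) (w+span⊆B c))
    where
    us : Vec (Vecₙ m) r
    us = Vec.map (Vec.take m) b
    ws : Vec (Vecₙ n) r
    ws = Vec.map (Vec.drop m) b
    concat-translates : ∀ v w c → (v ⊕ lincomb c us) Vec.++ (w ⊕ lincomb c ws) ≡ (v Vec.++ w) ⊕ lincomb c b
    concat-translates v w c = begin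
      (v ⊕ lincomb c us) Vec.++ (w ⊕ lincomb c ws)   ≡⟨ ⊕-++ v (lincomb c us) w (lincomb c ws) ⟨
      (v Vec.++ w) ⊕ (lincomb c us Vec.++ lincomb c ws) ≡⟨ cong ((v Vec.++ w) ⊕_) (lincomb-++ c us ws) ⟨
      (v Vec.++ w) ⊕ lincomb c (Vec.zipWith Vec._++_ us ws) ≡⟨ cong (λ b′ → (v Vec.++ w) ⊕ lincomb c b′) (zipWith-++-take-drop m b) ⟩
      (v Vec.++ w) ⊕ lincomb c b                      ∎

  allVectors : ∀ m → List (Vecₙ m)
  allVectors = vecsOver (List.allFin q)

  IsStrongKakeya-allVectors : ∀ {m r} → IsStrongKakeya r (allVectors m)
  IsStrongKakeya-allVectors b = zeroV , λ c → ∈-vecsOver ∈-allFin _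

  ∃-blockPower : ∀ {d r} {A : List (Vecₙ d)} → Unique A → IsStrongKakeya r A → ∀ k t →
    ∃[ K ] (Unique {A = Vecₙ (k ℕ.* d ℕ.+ t)} K × IsStrongKakeya r K × length K ≡ length A ℕ.^ k ℕ.* q ℕ.^ t)
  ∃-blockPower {d} {r} {A} !A A-Kakeya zero t =
    allVectors t , vecsOver⁺ (Uniqueₚ.allFin⁺ q) t , IsStrongKakeya-allVectors , (begin
      length (allVectors t)      ≡⟨ length-vecsOver (List.allFin q) t ⟩
      length (List.allFin q) ℕ.^ t ≡⟨ cong (ℕ._^ t) (length-allFin q) ⟩
      q ℕ.^ t                    ≡⟨ ℕₚ.*-identityˡ (q ℕ.^ t) ⟨
      1 ℕ.* q ℕ.^ t              ∎)
  ∃-blockPower {d} {r} {A} !A A-Kakeya (suc k) t with K , !K , K-Kakeya , |K| ← ∃-blockPower !A A-Kakeya k t =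
    subst Power (sym (ℕₚ.+-assoc d (k ℕ.* d) t))
      ( cartesianProductWith Vec._++_ A K
      , Uniqueₚ.cartesianProductWith⁺ Vec._++_ (λ {w} {x} → Vecₚ.++-injective w x) !A !K
      , IsStrongKakeya-++ A-Kakeya K-Kakeya
      , (begin
          length (cartesianProductWith Vec._++_ A K)  ≡⟨ length-cartesianProductWith Vec._++_ A K ⟩
          length A ℕ.* length K                       ≡⟨ cong (length A ℕ.*_) |K| ⟩
          length A ℕ.* (length A ℕ.^ k ℕ.* q ℕ.^ t)   ≡⟨ ℕₚ.*-assoc (length A) _ _ ⟨
          length A ℕ.^ suc k ℕ.* q ℕ.^ t              ∎))
    where
    Power : ℕ → Set
    Power n = ∃[ K ] (Unique {A = Vecₙ n} K × IsStrongKakeya r K × length K ≡ length A ℕ.^ suc k ℕ.* q ℕ.^ t)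

block-arithmetic : ∀ q {z p n β Q} → β ≤ q ℕ.* (q ℕ.* z) ℕ.+ (p ℕ.+ n) → 2 ℕ.* p ≡ q ℕ.* suc q → suc z ≤ Q →
  2 ℕ.* β ℕ.+ q ℕ.* q ≤ 2 ℕ.* (q ℕ.* (q ℕ.* Q)) ℕ.+ q ℕ.+ 2 ℕ.* n
block-arithmetic q {z} {p} {n} {β} {Q} β≤ 2p≡q[q+1] 1+z≤Q = begin
  2 ℕ.* β ℕ.+ q ℕ.* q
    ≤⟨ ℕₚ.+-monoˡ-≤ (q ℕ.* q) (ℕₚ.*-monoʳ-≤ 2 β≤) ⟩
  2 ℕ.* (q ℕ.* (q ℕ.* z) ℕ.+ (p ℕ.+ n)) ℕ.+ q ℕ.* q
    ≡⟨ expand q z p n ⟩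
  2 ℕ.* (q ℕ.* (q ℕ.* z)) ℕ.+ 2 ℕ.* p ℕ.+ 2 ℕ.* n ℕ.+ q ℕ.* q
    ≡⟨ cong (λ x → 2 ℕ.* (q ℕ.* (q ℕ.* z)) ℕ.+ x ℕ.+ 2 ℕ.* n ℕ.+ q ℕ.* q) 2p≡q[q+1] ⟩
  2 ℕ.* (q ℕ.* (q ℕ.* z)) ℕ.+ q ℕ.* suc q ℕ.+ 2 ℕ.* n ℕ.+ q ℕ.* q
    ≡⟨ collect q z n ⟩
  2 ℕ.* (q ℕ.* (q ℕ.* suc z)) ℕ.+ q ℕ.+ 2 ℕ.* n
    ≤⟨ ℕₚ.+-monoˡ-≤ (2 ℕ.* n) (ℕₚ.+-monoˡ-≤ q (ℕₚ.*-monoʳ-≤ 2 (ℕₚ.*-monoʳ-≤ q (ℕₚ.*-monoʳ-≤ q 1+z≤Q)))) ⟩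
  2 ℕ.* (q ℕ.* (q ℕ.* Q)) ℕ.+ q ℕ.+ 2 ℕ.* n ∎
  where
  open ℕₚ.≤-Reasoning
  expand : ∀ q z p n → 2 ℕ.* (q ℕ.* (q ℕ.* z) ℕ.+ (p ℕ.+ n)) ℕ.+ q ℕ.* q ≡ 2 ℕ.* (q ℕ.* (q ℕ.* z)) ℕ.+ 2 ℕ.* p ℕ.+ 2 ℕ.* n ℕ.+ q ℕ.* q
  expand = solve-∀
  collect : ∀ q z n → 2 ℕ.* (q ℕ.* (q ℕ.* z)) ℕ.+ q ℕ.* suc q ℕ.+ 2 ℕ.* n ℕ.+ q ℕ.* q ≡ 2 ℕ.* (q ℕ.* (q ℕ.* suc z)) ℕ.+ q ℕ.+ 2 ℕ.* n
  collect = solve-∀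

module RationalBounds where

  open ℤ using (+_)
  open ℚ using (ℚ; mkℚ; _+_; _*_; _-_; 1ℚ; 0ℚ; ½; _/_)

  fromℕ≡mkℚ : ∀ m → fromℕ m ≡ mkℚ (+ m) 0 (Coprime.sym (Coprime.1-coprimeTo m))
  fromℕ≡mkℚ m = ℚₚ.normalize-coprime (Coprime.sym (Coprime.1-coprimeTo m))

  fromℕ-+ : ∀ m n → fromℕ (m ℕ.+ n) ≡ fromℕ m + fromℕ n
  fromℕ-+ m n rewrite fromℕ≡mkℚ m | fromℕ≡mkℚ n =
    ℚₚ./-cong {+ (m ℕ.+ n)} {1} (sym (cong₂ ℤ._+_ (ℤₚ.*-identityʳ (+ m)) (ℤₚ.*-identityʳ (+ n)))) refl

  fromℕ-* : ∀ m n → fromℕ (m ℕ.* n) ≡ fromℕ m * fromℕ n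
  fromℕ-* m n rewrite fromℕ≡mkℚ m | fromℕ≡mkℚ n = ℚₚ./-cong {+ (m ℕ.* n)} {1} (ℤₚ.pos-* m n) refl

  fromℕ-mono-≤ : ∀ {m n} → m ℕ.≤ n → fromℕ m ≤ℚ fromℕ n
  fromℕ-mono-≤ {m} {n} m≤n rewrite fromℕ≡mkℚ m | fromℕ≡mkℚ n = ℚ.*≤* (ℤₚ.*-monoʳ-≤-nonNeg (+ 1) (ℤ.+≤+ m≤n))

  0≤fromℕ : ∀ n → 0ℚ ≤ℚ fromℕ n
  0≤fromℕ n = fromℕ-mono-≤ {0} {n} z≤n

  recip[2m]*m≡½ : ∀ m .{{_ : ℕ.NonZero m}} → recip (2 ℕ.* m) * fromℕ m ≡ ½
  recip[2m]*m≡½ (suc k) = begin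
    recip (2 ℕ.* suc k) * fromℕ (suc k)         ≡⟨ cong (recip (2 ℕ.* suc k) *_) (sym [2m]*½≡m) ⟩
    recip (2 ℕ.* suc k) * (fromℕ (2 ℕ.* suc k) * ½) ≡⟨ ℚₚ.*-assoc (recip (2 ℕ.* suc k)) _ ½ ⟨
    recip (2 ℕ.* suc k) * fromℕ (2 ℕ.* suc k) * ½   ≡⟨ cong (_* ½) (recip*m≡1 (2 ℕ.* suc k)) ⟩
    1ℚ * ½                                      ≡⟨ ℚₚ.*-identityˡ ½ ⟩
    ½                                           ∎
    where
    open ≡-Reasoning
    open +-*-Solver
    recip*m≡1 : ∀ m .{{_ : ℕ.NonZero m}} → recip m * fromℕ m ≡ 1ℚ
    recip*m≡1 (suc j) = trans (cong₂ _*_ (ℚₚ.normalize-coprime (Coprime.1-coprimeTo (suc j))) (fromℕ≡mkℚ (suc j)))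
                        (ℚₚ.*-inverseˡ (mkℚ (+ suc j) 0 (Coprime.sym (Coprime.1-coprimeTo (suc j)))))
    [2m]*½≡m : fromℕ (2 ℕ.* suc k) * ½ ≡ fromℕ (suc k)
    [2m]*½≡m = trans (cong (_* ½) (fromℕ-* 2 (suc k)))
                     (solve 1 (λ y → (con (fromℕ 2) :* y) :* con ½ := y) refl (fromℕ (suc k)))

  δ-even : ∀ q → q % 2 ≡ 0 → δ q ≡ 1ℚ
  δ-even q q-even with q % 2
  ... | zero  = refl
  ... | suc _ with () ← q-even

  δ-odd : ∀ q → q % 2 ≢ 0 → (q ≡ 3 × δ q ≡ + 5 / 3) ⊎ δ q ≡ + 3 / 1
  δ-odd q q-odd with q % 2
  ... | zero = ⊥-elim (q-odd refl)
  ... | suc _ with q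
  ...   | 3                       = inj₁ (refl , refl)
  ...   | 0                       = inj₂ refl
  ...   | 1                       = inj₂ refl
  ...   | 2                       = inj₂ refl
  ...   | suc (suc (suc (suc _))) = inj₂ refl

  δ-bound : ∀ q n → 2 ℕ.+ n ℕ.≤ q → (q % 2 ≡ 0 → n ≡ 0) → fromℕ q + fromℕ (2 ℕ.* n) ≤ℚ δ q * fromℕ q
  δ-bound q n 2+n≤q even⇒n≡0 with q % 2 ℕ.≟ 0
  ... | yes q-even rewrite δ-even q q-even | even⇒n≡0 q-even =
    ℚₚ.≤-reflexive (trans (ℚₚ.+-identityʳ (fromℕ q)) (sym (ℚₚ.*-identityˡ (fromℕ q))))
  ... | no q-odd with δ-odd q q-odd
  ...   | inj₁ (refl , δ≡5/3) rewrite δ≡5/3 = subst₂ _≤ℚ_ (fromℕ-+ 3 (2 ℕ.* n)) refl (fromℕ-mono-≤ 3+2n≤5)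
    where
    3+2n≤5 : 3 ℕ.+ 2 ℕ.* n ℕ.≤ 5
    3+2n≤5 = ℕₚ.+-monoʳ-≤ 3 (ℕₚ.*-monoʳ-≤ 2 (ℕₚ.≤-pred (ℕₚ.≤-pred 2+n≤q)))
  ...   | inj₂ δ≡3 rewrite δ≡3 = subst₂ _≤ℚ_ (fromℕ-+ q (2 ℕ.* n)) (fromℕ-* 3 q) (fromℕ-mono-≤ q+2n≤3q)
    where
    n≤q : n ℕ.≤ q
    n≤q = ℕₚ.≤-trans (ℕₚ.m≤n+m n 2) 2+n≤q
    q+2n≤3q : q ℕ.+ 2 ℕ.* n ℕ.≤ 3 ℕ.* q
    q+2n≤3q = ℕₚ.+-monoʳ-≤ q (ℕₚ.*-monoʳ-≤ 2 n≤q)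

  kakeyaFactor : ℕ → ℕ → ℚ
  kakeyaFactor q r = 1ℚ - (fromℕ q - δ q) * recip (2 ℕ.* q ℕ.^ r)

  kakeyaFactor-bound : ∀ q r {β n} .{{_ : ℕ.NonZero q}} →
    2 ℕ.* β ℕ.+ q ℕ.* q ℕ.≤ 2 ℕ.* q ℕ.^ suc r ℕ.+ q ℕ.+ 2 ℕ.* n →
    fromℕ q + fromℕ (2 ℕ.* n) ≤ℚ δ q * fromℕ q →
    fromℕ β ≤ℚ kakeyaFactor q r * fromℕ (q ℕ.^ suc r)
  kakeyaFactor-bound q r {β} {n} 2β+q²≤ q+2n≤δq = begin
    X                                      ≡⟨ solve 2 (λ X Q → X := con ½ :* ((con Two :* X :+ Q :* Q) :- Q :* Q)) refl X Q ⟩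
    ½ * ((Two * X + Q * Q) - Q * Q)        ≤⟨ ℚₚ.*-monoˡ-≤-nonNeg ½ (ℚₚ.+-monoˡ-≤ (ℚ.- (Q * Q)) 2X+Q²≤) ⟩
    ½ * ((Two * (Q * P) + d * Q) - Q * Q)  ≡⟨ solve 3 (λ Q P d → con ½ :* ((con Two :* (Q :* P) :+ d :* Q) :- Q :* Q)
                                                           := Q :* P :- (Q :- d) :* Q :* con ½) refl Q P d ⟩
    Q * P - (Q - d) * Q * ½                ≡⟨ cong (λ h → Q * P - (Q - d) * Q * h) (recip[2m]*m≡½ (q ℕ.^ r) {{ℕₚ.m^n≢0 q r}}) ⟨
    Q * P - (Q - d) * Q * (R * P)          ≡⟨ solve 4 (λ Q P d R → Q :* P :- (Q :- d) :* Q :* (R :* P)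
                                                           := (con 1ℚ :- (Q :- d) :* R) :* (Q :* P)) refl Q P d R ⟩
    kakeyaFactor q r * (Q * P)             ≡⟨ cong (kakeyaFactor q r *_) (fromℕ-* q (q ℕ.^ r)) ⟨
    kakeyaFactor q r * fromℕ (q ℕ.^ suc r) ∎
    where
    open ℚₚ.≤-Reasoning
    open +-*-Solver
    Two X Q P M d R : ℚ
    Two = fromℕ 2
    X = fromℕ β
    Q = fromℕ q
    P = fromℕ (q ℕ.^ r)
    M = fromℕ (2 ℕ.* n)
    d = δ q
    R = recip (2 ℕ.* q ℕ.^ r)
    2X+Q²≤ : Two * X + Q * Q ≤ℚ Two * (Q * P) + d * Q
    2X+Q²≤ = begin
      Two * X + Q * Q          ≡⟨ trans (fromℕ-+ (2 ℕ.* β) (q ℕ.* q)) (cong₂ _+_ (fromℕ-* 2 β) (fromℕ-* q q)) ⟨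
      fromℕ (2 ℕ.* β ℕ.+ q ℕ.* q) ≤⟨ fromℕ-mono-≤ 2β+q²≤ ⟩
      fromℕ (2 ℕ.* q ℕ.^ suc r ℕ.+ q ℕ.+ 2 ℕ.* n)
        ≡⟨ trans (fromℕ-+ (2 ℕ.* q ℕ.^ suc r ℕ.+ q) (2 ℕ.* n)) (cong (_+ M) (trans (fromℕ-+ (2 ℕ.* q ℕ.^ suc r) q)
             (cong (_+ Q) (trans (fromℕ-* 2 (q ℕ.^ suc r)) (cong (Two *_) (fromℕ-* q (q ℕ.^ r))))))) ⟩
      Two * (Q * P) + Q + M    ≡⟨ ℚₚ.+-assoc (Two * (Q * P)) Q M ⟩
      Two * (Q * P) + (Q + M)  ≤⟨ ℚₚ.+-monoʳ-≤ (Two * (Q * P)) q+2n≤δq ⟩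
      Two * (Q * P) + d * Q    ∎

  *-mono-≤-nonNeg : ∀ {a b c d} → 0ℚ ≤ℚ a → 0ℚ ≤ℚ c → a ≤ℚ b → c ≤ℚ d → a * c ≤ℚ b * d
  *-mono-≤-nonNeg {a} {b} {c} {d} 0≤a 0≤c a≤b c≤d =
    ℚₚ.≤-trans (ℚₚ.*-monoʳ-≤-nonNeg c {{ℚ.nonNegative 0≤c}} a≤b)
               (ℚₚ.*-monoˡ-≤-nonNeg b {{ℚ.nonNegative (ℚₚ.≤-trans 0≤a a≤b)}} c≤d)

  fromℕ-^-bound : ∀ {x y c} → fromℕ x ≤ℚ c * fromℕ y → ∀ k → fromℕ (x ℕ.^ k) ≤ℚ c ^ℚ k * fromℕ (y ℕ.^ k)
  fromℕ-^-bound {x} {y} {c} x≤cy zero    = ℚₚ.≤-reflexive (sym (ℚₚ.*-identityˡ (fromℕ 1)))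
  fromℕ-^-bound {x} {y} {c} x≤cy (suc k) = begin
    fromℕ (x ℕ.* x ℕ.^ k)                         ≡⟨ fromℕ-* x (x ℕ.^ k) ⟩
    fromℕ x * fromℕ (x ℕ.^ k)                     ≤⟨ *-mono-≤-nonNeg (0≤fromℕ x) (0≤fromℕ (x ℕ.^ k)) x≤cy (fromℕ-^-bound x≤cy k) ⟩
    (c * fromℕ y) * (c ^ℚ k * fromℕ (y ℕ.^ k))    ≡⟨ solve 4 (λ a b e f → (a :* b) :* (e :* f) := (a :* e) :* (b :* f)) refl c (fromℕ y) (c ^ℚ k) (fromℕ (y ℕ.^ k)) ⟩
    (c * c ^ℚ k) * (fromℕ y * fromℕ (y ℕ.^ k))    ≡⟨ cong (c * c ^ℚ k *_) (fromℕ-* y (y ℕ.^ k)) ⟨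
    c ^ℚ suc k * fromℕ (y ℕ.^ suc k)              ∎
    where
    open ℚₚ.≤-Reasoning
    open +-*-Solver

  fromℕ-blockPower-bound : ∀ {x q d c} → fromℕ x ≤ℚ c * fromℕ (q ℕ.^ d) →
    ∀ k t → fromℕ (x ℕ.^ k ℕ.* q ℕ.^ t) ≤ℚ c ^ℚ k * fromℕ (q ℕ.^ (k ℕ.* d ℕ.+ t))
  fromℕ-blockPower-bound {x} {q} {d} {c} x≤cq^d k t = begin
    fromℕ (x ℕ.^ k ℕ.* q ℕ.^ t)                          ≡⟨ fromℕ-* (x ℕ.^ k) (q ℕ.^ t) ⟩
    fromℕ (x ℕ.^ k) * fromℕ (q ℕ.^ t)                    ≤⟨ ℚₚ.*-monoʳ-≤-nonNeg (fromℕ (q ℕ.^ t)) {{ℚ.nonNegative (0≤fromℕ (q ℕ.^ t))}}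
                                                               (fromℕ-^-bound x≤cq^d k) ⟩
    (c ^ℚ k * fromℕ ((q ℕ.^ d) ℕ.^ k)) * fromℕ (q ℕ.^ t) ≡⟨ ℚₚ.*-assoc (c ^ℚ k) _ _ ⟩
    c ^ℚ k * (fromℕ ((q ℕ.^ d) ℕ.^ k) * fromℕ (q ℕ.^ t)) ≡⟨ cong (c ^ℚ k *_) (fromℕ-* ((q ℕ.^ d) ℕ.^ k) (q ℕ.^ t)) ⟨
    c ^ℚ k * fromℕ ((q ℕ.^ d) ℕ.^ k ℕ.* q ℕ.^ t)          ≡⟨ cong (λ e → c ^ℚ k * fromℕ e) exponents ⟩
    c ^ℚ k * fromℕ (q ℕ.^ (k ℕ.* d ℕ.+ t))              ∎
    where
    open ℚₚ.≤-Reasoning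
    exponents : (q ℕ.^ d) ℕ.^ k ℕ.* q ℕ.^ t ≡ q ℕ.^ (k ℕ.* d ℕ.+ t)
    exponents = sym (trans (ℕₚ.^-distribˡ-+-* q (k ℕ.* d) t)
                  (cong (ℕ._* q ℕ.^ t) (trans (cong (q ℕ.^_) (ℕₚ.*-comm k d)) (sym (ℕₚ.^-*-assoc q d k)))))

module Block {q : ℕ} (F : FieldOn q) where

  open FieldProperties F
  open VectorSpace F
  open Kakeya F
  open RationalBounds using (kakeyaFactor; kakeyaFactor-bound; δ-bound)
  open ≡-Reasoning

  negSquare : Fin q → Fin q
  negSquare m = m * - m

  IsNegSquare : Fin q → Set
  IsNegSquare y = ∃[ m ] negSquare m ≡ y

  isNegSquare? : Decidable IsNegSquare
  isNegSquare? y = Finₚ.any? (λ m → negSquare m ≟ y)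

  missed : List (Fin q)
  missed = filter (¬? ∘ isNegSquare?) (allFin q)

  missed⇒¬IsNegSquare : ∀ {y} → y ∈ missed → ¬ IsNegSquare y
  missed⇒¬IsNegSquare y∈ = proj₂ (∈-filter⁻ (¬? ∘ isNegSquare?) {xs = allFin q} y∈)

  IsNegSquare⇒∉missed : ∀ {x} → IsNegSquare x → All (x ≢_) missed
  IsNegSquare⇒∉missed sq = All.tabulate λ { y∈ refl → missed⇒¬IsNegSquare y∈ sq }

  2+|missed|≤q : 2 ℕ.+ length missed ≤ q
  2+|missed|≤q = subst (2 ℕ.+ length missed ≤_) (length-allFin q) (Unique-⊆⇒length≤
    ( (0≢-1 ∷ IsNegSquare⇒∉missed (0# , zeroˡ (- 0#)))
    ∷ IsNegSquare⇒∉missed (1# , *-identityˡ (- 1#))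
    ∷ Uniqueₚ.filter⁺ (¬? ∘ isNegSquare?) (Uniqueₚ.allFin⁺ q))
    (λ {x} _ → ∈-allFin x))
    where
    0≢-1 : 0# ≢ - 1#
    0≢-1 0≡-1 = 0#≢1# (trans (sym -0#≈0#) (trans (cong -_ 0≡-1) (-‿involutive 1#)))

  negSquare-injective : 1# + 1# ≡ 0# → ∀ {m n} → negSquare m ≡ negSquare n → m ≡ n
  negSquare-injective 2≡0 {m} {n} m[-m]≡n[-n] = begin
    m        ≡⟨ +-inverseʳ-unique m m (x+x≡0 m) ⟩
    - m      ≡⟨ +-inverseʳ-unique m n m+n≡0 ⟨
    n        ∎
    where
    x+x≡0 : ∀ x → x + x ≡ 0#
    x+x≡0 = 1+1≡0⇒x+x≡0 2≡0
    mm≡nn : m * m ≡ n * n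
    mm≡nn = -‿injective (trans (-‿distribʳ-* m m) (trans m[-m]≡n[-n] (sym (-‿distribʳ-* n n))))
    m+n≡0 : m + n ≡ 0#
    m+n≡0 = x*x≡0⇒x≡0 (begin
      (m + n) * (m + n)                      ≡⟨ distribʳ (m + n) m n ⟩
      m * (m + n) + n * (m + n)              ≡⟨ cong₂ _+_ (distribˡ m m n) (trans (distribˡ n m n) (+-comm (n * m) (n * n))) ⟩
      (m * m + m * n) + (n * n + n * m)      ≡⟨ +-interchange (m * m) (m * n) (n * n) (n * m) ⟩
      (m * m + n * n) + (m * n + n * m)      ≡⟨ cong₂ _+_ (cong (m * m +_) (sym mm≡nn)) (cong (m * n +_) (*-comm n m)) ⟩
      (m * m + m * m) + (m * n + m * n)      ≡⟨ cong₂ _+_ (x+x≡0 (m * m)) (x+x≡0 (m * n)) ⟩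
      0# + 0#                                ≡⟨ +-identityˡ 0# ⟩
      0#                                     ∎)

  even⇒missed≡[] : q % 2 ≡ 0 → missed ≡ []
  even⇒missed≡[] q-even = Listₚ.filter-none (¬? ∘ isNegSquare?) {xs = allFin q}
    (All.tabulate λ {y} _ ¬sq → ¬sq (injective⇒surjective (negSquare-injective (even⇒1+1≡0 q-even)) y))

  q-nonZero : ℕ.NonZero q
  q-nonZero = ℕ.>-nonZero (ℕₚ.≤-trans (s≤s z≤n) 2+|missed|≤q)

  sumProd : Fin q × Fin q → Fin q × Fin q
  sumProd (s , t) = s + t , s * t

  K₂ : List (Fin q × Fin q)
  K₂ = map sumProd (unorderedPairs (allFin q)) ++ map (0# ,_) missed

  length-K₂ : length K₂ ≡ length (unorderedPairs (allFin q)) ℕ.+ length missed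
  length-K₂ = trans (Listₚ.length-++ (map sumProd (unorderedPairs (allFin q))))
    (cong₂ ℕ._+_ (Listₚ.length-map sumProd (unorderedPairs (allFin q))) (Listₚ.length-map (0# ,_) missed))

  sumProd∈K₂ : ∀ s t → (s + t , s * t) ∈ K₂
  sumProd∈K₂ s t with ∈-unorderedPairs (∈-allFin s) (∈-allFin t)
  ... | inj₁ st∈ = ∈-++⁺ˡ (∈-map⁺ sumProd st∈)
  ... | inj₂ ts∈ = subst (_∈ K₂) (cong₂ _,_ (+-comm t s) (*-comm t s)) (∈-++⁺ˡ (∈-map⁺ sumProd ts∈))

  axis⊆K₂ : ∀ y → (0# , y) ∈ K₂
  axis⊆K₂ y with isNegSquare? y
  ... | yes (m , m[-m]≡y) = subst (_∈ K₂) (cong₂ _,_ (-‿inverseʳ m) m[-m]≡y) (sumProd∈K₂ m (- m))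
  ... | no  ¬sq           = ∈-++⁺ʳ (map sumProd _) (∈-map⁺ (0# ,_) (∈-filter⁺ (¬? ∘ isNegSquare?) (∈-allFin y) ¬sq))

  tangent⊆K₂ : ∀ μ x → (x , μ * (x + - μ)) ∈ K₂
  tangent⊆K₂ μ x = subst (λ s → (s , μ * (x + - μ)) ∈ K₂) μ+[x-μ]≡x (sumProd∈K₂ μ (x + - μ))
    where
    μ+[x-μ]≡x : μ + (x + - μ) ≡ x
    μ+[x-μ]≡x = begin
      μ + (x + - μ)  ≡⟨ cong (μ +_) (+-comm x (- μ)) ⟩
      μ + (- μ + x)  ≡⟨ +-assoc μ (- μ) x ⟨
      μ + - μ + x    ≡⟨ cong (_+ x) (-‿inverseʳ μ) ⟩
      0# + x         ≡⟨ +-identityˡ x ⟩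
      x              ∎

  K₂-levelSet : ∀ a₁ a₂ → ∃[ t ] (∀ x y → a₁ * x + a₂ * y ≡ t → (x , y) ∈ K₂)
  K₂-levelSet a₁ a₂ with a₂ ≟ 0# | a₁ ≟ 0#
  ... | no a₂≢0 | _ = a₂ * - (μ * μ) , λ x y on-line →
    subst (λ y → (x , y) ∈ K₂) (sym (*-cancelˡ a₂≢0 (a₂y≡ x y on-line))) (tangent⊆K₂ μ x)
    where
    μ : Fin q
    μ = - (a₁ * inv a₂)
    a₂μ≡-a₁ : a₂ * μ ≡ - a₁
    a₂μ≡-a₁ = begin
      a₂ * - (a₁ * inv a₂)  ≡⟨ -‿distribʳ-* a₂ (a₁ * inv a₂) ⟨
      - (a₂ * (a₁ * inv a₂)) ≡⟨ cong -_ (trans (sym (*-assoc a₂ a₁ (inv a₂)))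
                                (trans (cong (_* inv a₂) (*-comm a₂ a₁)) (*-assoc a₁ a₂ (inv a₂)))) ⟩
      - (a₁ * (a₂ * inv a₂)) ≡⟨ cong (λ t → - (a₁ * t)) (inv-r a₂ a₂≢0) ⟩
      - (a₁ * 1#)            ≡⟨ cong -_ (*-identityʳ a₁) ⟩
      - a₁                   ∎
    a₂y≡ : ∀ x y → a₁ * x + a₂ * y ≡ a₂ * - (μ * μ) → a₂ * y ≡ a₂ * (μ * (x + - μ))
    a₂y≡ x y on-line = begin
      a₂ * y                            ≡⟨ x+y≡z⇒y≡-x+z on-line ⟩
      - (a₁ * x) + a₂ * - (μ * μ)       ≡⟨ cong (_+ a₂ * - (μ * μ)) (trans (-‿distribˡ-* a₁ x) (cong (_* x) (sym a₂μ≡-a₁))) ⟩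
      a₂ * μ * x + a₂ * - (μ * μ)       ≡⟨ cong₂ _+_ (*-assoc a₂ μ x) (cong (a₂ *_) (-‿distribʳ-* μ μ)) ⟩
      a₂ * (μ * x) + a₂ * (μ * - μ)     ≡⟨ distribˡ a₂ (μ * x) (μ * - μ) ⟨
      a₂ * (μ * x + μ * - μ)            ≡⟨ cong (a₂ *_) (distribˡ μ x (- μ)) ⟨
      a₂ * (μ * (x + - μ))              ∎
  ... | yes refl | no a₁≢0 = 0# , λ x y on-axis →
    subst (λ x → (x , y) ∈ K₂) (sym (x*y≡0⇒y≡0 a₁≢0 (trans (sym (trans (cong (a₁ * x +_) (zeroˡ y)) (+-identityʳ _))) on-axis))) (axis⊆K₂ y)
  ... | yes refl | yes refl = 1# , λ x y 0≡1 →
    ⊥-elim (0#≢1# (trans (sym (trans (cong₂ _+_ (zeroˡ x) (zeroˡ y)) (+-identityˡ 0#))) 0≡1))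

  _≟ᵥ_ : ∀ {n} (v w : Vecₙ n) → Dec (v ≡ w)
  _≟ᵥ_ = Vecₚ.≡-dec _≟_

  open import Data.List.Membership.DecPropositional (Productₚ.≡-dec _≟_ _≟_) using (_∈?_)

  module _ (m : ℕ) where

    Admissible : Vecₙ (2 ℕ.+ m) → Set
    Admissible (x ∷ y ∷ w) = w ≢ zeroV ⊎ (x , y) ∈ K₂

    admissible? : Decidable Admissible
    admissible? (x ∷ y ∷ w) = ¬? (w ≟ᵥ zeroV) ⊎-dec ((x , y) ∈? K₂)

    B : List (Vecₙ (2 ℕ.+ m))
    B = filter admissible? (allVectors (2 ℕ.+ m))

    Unique-B : Unique B
    Unique-B = Uniqueₚ.filter⁺ admissible? (vecsOver⁺ (Uniqueₚ.allFin⁺ q) (2 ℕ.+ m))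

    ∙-planar : ∀ a₁ a₂ (a : Vecₙ m) x y → (a₁ ∷ a₂ ∷ a) ∙ (x ∷ y ∷ zeroV) ≡ a₁ * x + a₂ * y
    ∙-planar a₁ a₂ a x y = cong (λ t → a₁ * x + t) (trans (cong (a₂ * y +_) (∙-zeroʳ a)) (+-identityʳ _))

    B-levelSet : ∀ a → ∃[ t ] (∀ z → a ∙ z ≡ t → z ∈ B)
    B-levelSet (a₁ ∷ a₂ ∷ a) with t , line⊆K₂ ← K₂-levelSet a₁ a₂ =
      t , λ z a∙z≡t → ∈-filter⁺ admissible? (∈-vecsOver ∈-allFin z) (admissible z a∙z≡t)
      where
      admissible : ∀ z → (a₁ ∷ a₂ ∷ a) ∙ z ≡ t → Admissible z
      admissible (x ∷ y ∷ w) a∙z≡t with w ≟ᵥ zeroV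
      ... | no  w≢0  = inj₁ w≢0
      ... | yes refl = inj₂ (line⊆K₂ x y (trans (sym (∙-planar a₁ a₂ a x y)) a∙z≡t))

    IsStrongKakeya-B : IsStrongKakeya (suc m) B
    IsStrongKakeya-B = levelSets⇒IsStrongKakeya B (λ a _ → B-levelSet a)

    nonzeroVectors : List (Vecₙ m)
    nonzeroVectors = filter (λ w → ¬? (w ≟ᵥ zeroV)) (allVectors m)

    1+|nonzeroVectors|≤q^m : suc (length nonzeroVectors) ≤ q ℕ.^ m
    1+|nonzeroVectors|≤q^m = subst (suc (length nonzeroVectors) ≤_) |allVectors|≡q^m
      (Unique-⊆⇒length≤ (zero∉ ∷ Uniqueₚ.filter⁺ _ (vecsOver⁺ (Uniqueₚ.allFin⁺ q) m)) (λ {w} _ → ∈-vecsOver ∈-allFin w))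
      where
      |allVectors|≡q^m : length (allVectors m) ≡ q ℕ.^ m
      |allVectors|≡q^m = trans (length-vecsOver (allFin q) m) (cong (ℕ._^ m) (length-allFin q))
      zero∉ : All (zeroV ≢_) nonzeroVectors
      zero∉ = All.tabulate λ w∈ 0≡w → proj₂ (∈-filter⁻ _ {xs = allVectors m} w∈) (sym 0≡w)

    planar : Fin q × Fin q → Vecₙ (2 ℕ.+ m)
    planar (x , y) = x ∷ y ∷ zeroV

    B-cover : List (Vecₙ (2 ℕ.+ m))
    B-cover = cartesianProductWith _∷_ (allFin q) (cartesianProductWith _∷_ (allFin q) nonzeroVectors) ++ map planar K₂

    B⊆B-cover : B ⊆ B-cover
    B⊆B-cover {x ∷ y ∷ w} z∈B with w ≟ᵥ zeroV | proj₂ (∈-filter⁻ admissible? {xs = allVectors (2 ℕ.+ m)} z∈B)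
    ... | no w≢0   | _          = ∈-++⁺ˡ (∈-cartesianProductWith⁺ _∷_ (∈-allFin x)
                                   (∈-cartesianProductWith⁺ _∷_ (∈-allFin y) (∈-filter⁺ _ (∈-vecsOver ∈-allFin w) w≢0)))
    ... | yes refl | inj₁ 0≢0   = ⊥-elim (0≢0 refl)
    ... | yes refl | inj₂ xy∈K₂ = ∈-++⁺ʳ _ (∈-map⁺ planar xy∈K₂)

    length-B-cover : length B-cover ≡ q ℕ.* (q ℕ.* length nonzeroVectors) ℕ.+ length K₂
    length-B-cover = begin
      length B-cover
        ≡⟨ Listₚ.length-++ (cartesianProductWith _∷_ (allFin q) _) ⟩
      length (cartesianProductWith _∷_ (allFin q) (cartesianProductWith _∷_ (allFin q) nonzeroVectors)) ℕ.+ length (map planar K₂)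
        ≡⟨ cong₂ ℕ._+_ (length-cartesianProductWith _∷_ (allFin q) _) (Listₚ.length-map planar K₂) ⟩
      length (allFin q) ℕ.* length (cartesianProductWith _∷_ (allFin q) nonzeroVectors) ℕ.+ length K₂
        ≡⟨ cong (λ l → length (allFin q) ℕ.* l ℕ.+ length K₂) (length-cartesianProductWith _∷_ (allFin q) nonzeroVectors) ⟩
      length (allFin q) ℕ.* (length (allFin q) ℕ.* length nonzeroVectors) ℕ.+ length K₂
        ≡⟨ cong (λ l → l ℕ.* (l ℕ.* length nonzeroVectors) ℕ.+ length K₂) (length-allFin q) ⟩
      q ℕ.* (q ℕ.* length nonzeroVectors) ℕ.+ length K₂ ∎

    length-B-bound : 2 ℕ.* length B ℕ.+ q ℕ.* q ≤ 2 ℕ.* q ℕ.^ (2 ℕ.+ m) ℕ.+ q ℕ.+ 2 ℕ.* length missed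
    length-B-bound = block-arithmetic q {n = length missed} {Q = q ℕ.^ m} |B|≤ 2|pairs|≡q[q+1] 1+|nonzeroVectors|≤q^m
      where
      |B|≤ : length B ≤ q ℕ.* (q ℕ.* length nonzeroVectors) ℕ.+ (length (unorderedPairs (allFin q)) ℕ.+ length missed)
      |B|≤ = subst (length B ≤_) (trans length-B-cover (cong (q ℕ.* (q ℕ.* length nonzeroVectors) ℕ.+_) length-K₂))
               (Unique-⊆⇒length≤ Unique-B B⊆B-cover)
      2|pairs|≡q[q+1] : 2 ℕ.* length (unorderedPairs (allFin q)) ≡ q ℕ.* suc q
      2|pairs|≡q[q+1] = trans (length-unorderedPairs (allFin q)) (cong (λ l → l ℕ.* suc l) (length-allFin q))

    B-bound : fromℕ (length B) ≤ℚ kakeyaFactor q (suc m) ℚ.* fromℕ (q ℕ.^ (2 ℕ.+ m))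
    B-bound = kakeyaFactor-bound q (suc m) {length B} {length missed} {{q-nonZero}} length-B-bound
      (δ-bound q (length missed) 2+|missed|≤q (cong length ∘ even⇒missed≡[]))

open Kakeya using (∃-blockPower)
open Block using (B; Unique-B; IsStrongKakeya-B; B-bound)
open RationalBounds using (kakeyaFactor; fromℕ-blockPower-bound)

theorem2 : ∀ (q : ℕ) (F : FieldOn q) (n r : ℕ) → 1 ≤ r → r ≤ n →
    ∃[ K ] (Unique K × IsKakeya F {n} r K × fromℕ (length K) ≤ℚ kakeyaBound q n r)
theorem2 q F n zero    () _
theorem2 q F n (suc m) _  _ =
  let K , !K , K-Kakeya , |K| = ∃-blockPower F (Unique-B F m) (IsStrongKakeya-B F m) k t
  in  subst Bounded n≡kd+t (K , !K , (λ b _ → K-Kakeya b) , bound |K|)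
  where
  d k t : ℕ
  d = 2 ℕ.+ m
  k = n ℕ./ d
  t = n % d
  Bounded : ℕ → Set
  Bounded n′ = ∃[ K ] (Unique K × IsKakeya F {n′} (suc m) K ×
                       fromℕ (length K) ≤ℚ kakeyaFactor q (suc m) ^ℚ k ℚ.* fromℕ (q ℕ.^ n′))
  n≡kd+t : k ℕ.* d ℕ.+ t ≡ n
  n≡kd+t = trans (ℕₚ.+-comm (k ℕ.* d) t) (sym (m≡m%n+[m/n]*n n d))
  bound : ∀ {l} → l ≡ length (B F m) ℕ.^ k ℕ.* q ℕ.^ t →
    fromℕ l ≤ℚ kakeyaFactor q (suc m) ^ℚ k ℚ.* fromℕ (q ℕ.^ (k ℕ.* d ℕ.+ t))
  bound refl = fromℕ-blockPower-bound (B-bound F m) k t
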